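{- Let $p$ be a prime. The series $\sum_{n=0}^{\infty} p^{v_p(n!)}$ converges in $\mathbb{Z}_p$, and the $p$-adic expansion of its sum is not (eventually) periodic.
   Context: $\mathbb{Z}_p$ is the ring of $p$-adic integers. For a positive integer $m$, $v_p(m)$ denotes the exponent of the highest power of $p$ dividing $m$. The $p$-adic expansion of $\alpha \in \mathbb{Z}_p$ is the unique digit sequence $(a_i)_{i\ge 0}$ with $a_i \in \{0,\dots,p-1\}$ and $\alpha = \sum_{i\ge0} a_i p^i$; it is called periodic if the sequence $(a_i)$ is eventually periodic. -}

module Defs where

open import Data.Nat using (ℕ; zero; suc; _+_; _*_; _^_; _≤_; _<_; _!)
open import Data.Nat.DivMod using (_/_; _%_)

open import Data.Nat.Properties using (_≟_)
open import Data.Product using (Σ; ∃; _×_)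
open import Relation.Nullary using (yes; no)
open import Relation.Binary.PropositionalEquality using (_≡_)

-- Computed by repeated division, with fuel (v_p(m) ≤ m).
-- Conventions for degenerate inputs (p ≤ 1 or m = 0) are irrelevant here.
vpAux : ℕ → ℕ → ℕ → ℕ
vpAux zero _ _ = 0
vpAux (suc f) (suc (suc q)) (suc m) with (suc m) % (suc (suc q)) ≟ 0
... | yes _ = suc (vpAux f (suc (suc q)) (suc m / suc (suc q)))
... | no  _ = 0
vpAux (suc f) _ _ = 0

vp : ℕ → ℕ → ℕ
vp p m = vpAux m p m

sumBelow : ℕ → (ℕ → ℕ) → ℕ
sumBelow zero    f = 0
sumBelow (suc n) f = sumBelow n f + f n

partialSum : ℕ → ℕ → ℕ
partialSum p N = sumBelow N (λ n → p ^ vp p (n !))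

digitSum : (ℕ → ℕ) → ℕ → ℕ → ℕ
digitSum a p k = sumBelow k (λ i → a i * p ^ i)

-- x ≡ y (mod m), with y the smaller representative
CongrMod : ℕ → ℕ → ℕ → Set
CongrMod m x y = ∃ λ q → x ≡ y + q * m

-- The p-adic integer with digit sequence a is the limit in ℤ_p of the
-- partial sums: for every k, eventually S_N ≡ Σ_{i<k} a_i p^i (mod p^k).
SeriesConvergesTo : ℕ → (ℕ → ℕ) → Set
SeriesConvergesTo p a =
  ∀ k → ∃ λ N₀ → ∀ N → N₀ ≤ N → CongrMod (p ^ k) (partialSum p N) (digitSum a p k)

EventuallyPeriodic : (ℕ → ℕ) → Set
EventuallyPeriodic a = ∃ λ s → ∃ λ t → (0 < t) × (∀ i → s ≤ i → a (i + t) ≡ a i)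

-- Write e(n) = v_p(n!).  Among n = mp, …, mp + p − 1 only the first is divisible
-- by p, so e is constant on that block, and it jumps by v_p(mp) = 1 + v_p(m+1)
-- when passing to the next block.  The p terms of block m therefore add up to
-- p^(e(mp)+1), and these exponents strictly increase with m.  Hence the sum of
-- the series has digit 1 exactly at the positions e(mp) + 1 and 0 elsewhere;
-- the block m = p^L − 1 is followed by a run of L zero digits, and runs of zeros
-- of unbounded length rule out periodicity.
module Submission where

open import Defs
open import Data.Nat using (ℕ; _<_)
open import Data.Nat.Primality using (Prime)
open import Data.Product using (Σ; _×_)
open import Relation.Nullary using (¬_)
open import Data.Nat
  using (zero; suc; pred; _+_; _*_; _∸_; _^_; _≤_; _!; z≤n; s≤s)
open import Data.Nat.Properties
open import Data.Nat.DivMod using (_/_; _%_; m*[n/m]≡n; m/n<m; m≥n⇒m/n>0)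
open import Data.Nat.Divisibility
open import Data.Nat.Primality using (euclidsLemma)
open import Data.Nat.Solver using (module +-*-Solver)
open import Data.Product using (_,_)
open import Data.Sum using (inj₁; inj₂)
open import Function using (_∘_)
open import Relation.Nullary using (yes; no; contradiction)
open import Relation.Binary.PropositionalEquality

open +-*-Solver

congrMod-refl : ∀ {m} x → CongrMod m x x
congrMod-refl x = 0 , sym (+-identityʳ x)

congrMod-trans : ∀ {m x y z} → CongrMod m x y → CongrMod m y z → CongrMod m x z
congrMod-trans {m} {x} {y} {z} (a , x≡y+am) (b , y≡z+bm) = b + a , (begin
  x                  ≡⟨ x≡y+am ⟩
  y + a * m          ≡⟨ cong (_+ a * m) y≡z+bm ⟩
  z + b * m + a * m  ≡⟨ solve 4 (λ z b a m → z :+ b :* m :+ a :* m := z :+ (b :+ a) :* m)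
                              refl z b a m ⟩
  z + (b + a) * m    ∎)
  where open ≡-Reasoning

congrMod-+ʳ : ∀ {m d} x → m ∣ d → CongrMod m (x + d) x
congrMod-+ʳ x (divides c refl) = c , refl

sumBelow-congrMod : ∀ {m} f N₀ → (∀ n → N₀ ≤ n → m ∣ f n) →
                    ∀ N → N₀ ≤ N → CongrMod m (sumBelow N f) (sumBelow N₀ f)
sumBelow-congrMod {m} f N₀ m∣f N N₀≤N =
  subst (λ M → CongrMod m (sumBelow M f) (sumBelow N₀ f)) (m∸n+n≡m N₀≤N) (tail (N ∸ N₀))
  where
  tail : ∀ d → CongrMod m (sumBelow (d + N₀) f) (sumBelow N₀ f)
  tail zero    = congrMod-refl _
  tail (suc d) = congrMod-trans (congrMod-+ʳ _ (m∣f (d + N₀) (m≤n+m N₀ d))) (tail d)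

m^n∣m^o : ∀ m {n o} → n ≤ o → m ^ n ∣ m ^ o
m^n∣m^o m {n} {o} n≤o = subst (m ^ n ∣_) m^n*m^[o∸n]≡m^o (m∣m*n (m ^ (o ∸ n)))
  where
  m^n*m^[o∸n]≡m^o : m ^ n * m ^ (o ∸ n) ≡ m ^ o
  m^n*m^[o∸n]≡m^o = trans (sym (^-distribˡ-+-* m n (o ∸ n))) (cong (m ^_) (m+[n∸m]≡n n≤o))

ZeroRun : (ℕ → ℕ) → ℕ → Set
ZeroRun a L = Σ ℕ λ j → L ≤ j × a j ≡ 1 × (∀ i → 0 < i → i ≤ L → a (j + i) ≡ 0)

unboundedZeroRuns⇒¬EventuallyPeriodic : ∀ a → (∀ L → ZeroRun a L) → ¬ EventuallyPeriodic a
unboundedZeroRuns⇒¬EventuallyPeriodic a runs (s , t , 0<t , periodic)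
  with runs (s + t)
... | j , s+t≤j , aj≡1 , zeros =
  1+n≢0 (trans (sym aj≡1) (trans (sym (periodic j s≤j)) (zeros t 0<t (m≤n+m t s))))
  where
  s≤j : s ≤ j
  s≤j = ≤-trans (m≤m+n s t) s+t≤j

imageIndicator : (ℕ → ℕ) → ℕ → ℕ → ℕ
imageIndicator f zero    k = 0
imageIndicator f (suc b) k with f b ≟ k
... | yes _ = 1
... | no  _ = imageIndicator f b k

imageIndicator-≤1 : ∀ f b k → imageIndicator f b k ≤ 1
imageIndicator-≤1 f zero    k = z≤n
imageIndicator-≤1 f (suc b) k with f b ≟ k
... | yes _ = ≤-refl
... | no  _ = imageIndicator-≤1 f b k

imageIndicator-hit : ∀ f {m b} → m < b → imageIndicator f b (f m) ≡ 1
imageIndicator-hit f {m} {suc b} m<1+b with f b ≟ f m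
... | yes _ = refl
... | no fb≢fm with m≤n⇒m<n∨m≡n (≤-pred m<1+b)
...   | inj₁ m<b  = imageIndicator-hit f m<b
...   | inj₂ refl = contradiction refl fb≢fm

imageIndicator-miss : ∀ f b {k} → (∀ m → f m ≢ k) → imageIndicator f b k ≡ 0
imageIndicator-miss f zero    k∉f = refl
imageIndicator-miss f (suc b) {k} k∉f with f b ≟ k
... | yes fb≡k = contradiction fb≡k (k∉f b)
... | no  _    = imageIndicator-miss f b k∉f

module Valuation (q : ℕ) where

  p : ℕ
  p = suc (suc q)

  IsValuation : ℕ → ℕ → Set
  IsValuation m v = Σ ℕ λ r → m ≡ p ^ v * r × ¬ p ∣ r

  isValuation-p* : ∀ {m v} → IsValuation m v → IsValuation (p * m) (suc v)
  isValuation-p* {v = v} (r , m≡p^v*r , p∤r) =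
    r , trans (cong (p *_) m≡p^v*r) (sym (*-assoc p (p ^ v) r)) , p∤r

  vpAux-isValuation : ∀ fuel m → 0 < m → m ≤ fuel → IsValuation m (vpAux fuel p m)
  vpAux-isValuation (suc fuel) (suc m) _ m<1+fuel with suc m % p ≟ 0
  ... | no  r≢0 = suc m , sym (*-identityˡ (suc m)) , r≢0 ∘ n∣m⇒m%n≡0 (suc m) p
  ... | yes r≡0 = subst (λ n → IsValuation n (suc v)) (m*[n/m]≡n p∣1+m)
                        (isValuation-p* {suc m / p} {v} quot-isValuation)
    where
    v = vpAux fuel p (suc m / p)
    p∣1+m : p ∣ suc m
    p∣1+m = m%n≡0⇒n∣m (suc m) p r≡0
    0<quot : 0 < suc m / p
    0<quot = m≥n⇒m/n>0 (∣⇒≤ p∣1+m)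
    quot≤fuel : suc m / p ≤ fuel
    quot≤fuel = ≤-pred (≤-trans (m/n<m (suc m) p (s≤s (s≤s z≤n))) m<1+fuel)
    quot-isValuation : IsValuation (suc m / p) v
    quot-isValuation = vpAux-isValuation fuel (suc m / p) 0<quot quot≤fuel

  vp-isValuation : ∀ {m} → 0 < m → IsValuation m (vp p m)
  vp-isValuation {m} 0<m = vpAux-isValuation m m 0<m ≤-refl

  p∣p^[1+n]*m : ∀ n m → p ∣ p ^ suc n * m
  p∣p^[1+n]*m n m = ∣-trans (m∣m*n (p ^ n)) (m∣m*n m)

  valuation-unique : ∀ v w {r s} → p ^ v * r ≡ p ^ w * s → ¬ p ∣ r → ¬ p ∣ s → v ≡ w
  valuation-unique zero    zero    _ _ _ = refl
  valuation-unique zero    (suc w) {r} {s} eq p∤r _ =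
    contradiction (subst (p ∣_) (trans (sym eq) (*-identityˡ r)) (p∣p^[1+n]*m w s)) p∤r
  valuation-unique (suc v) zero    {r} {s} eq _ p∤s =
    contradiction (subst (p ∣_) (trans eq (*-identityˡ s)) (p∣p^[1+n]*m v r)) p∤s
  valuation-unique (suc v) (suc w) {r} {s} eq p∤r p∤s =
    cong suc (valuation-unique v w (*-cancelˡ-≡ _ _ p p*[p^v*r]≡p*[p^w*s]) p∤r p∤s)
    where
    p*[p^v*r]≡p*[p^w*s] : p * (p ^ v * r) ≡ p * (p ^ w * s)
    p*[p^v*r]≡p*[p^w*s] = trans (sym (*-assoc p (p ^ v) r)) (trans eq (*-assoc p (p ^ w) s))

  vp-unique : ∀ {m v} → 0 < m → IsValuation m v → vp p m ≡ v
  vp-unique 0<m (s , m≡p^v*s , p∤s) with vp-isValuation 0<m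
  ... | r , m≡p^u*r , p∤r = valuation-unique _ _ (trans (sym m≡p^u*r) m≡p^v*s) p∤r p∤s

  vp-* : Prime p → ∀ {m n} → 0 < m → 0 < n → vp p (m * n) ≡ vp p m + vp p n
  vp-* p-prime {m} {n} 0<m 0<n with vp-isValuation 0<m | vp-isValuation 0<n
  ... | r , m≡ , p∤r | s , n≡ , p∤s = vp-unique (*-mono-≤ 0<m 0<n) (r * s , mn≡ , p∤rs)
    where
    u = vp p m
    v = vp p n
    mn≡ : m * n ≡ p ^ (u + v) * (r * s)
    mn≡ = begin
      m * n                        ≡⟨ cong₂ _*_ m≡ n≡ ⟩
      (p ^ u * r) * (p ^ v * s)    ≡⟨ solve 4 (λ x y r s → (x :* r) :* (y :* s) := (x :* y) :* (r :* s))
                                             refl (p ^ u) (p ^ v) r s ⟩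
      (p ^ u * p ^ v) * (r * s)    ≡⟨ cong (_* (r * s)) (sym (^-distribˡ-+-* p u v)) ⟩
      p ^ (u + v) * (r * s)        ∎
      where open ≡-Reasoning
    p∤rs : ¬ p ∣ r * s
    p∤rs p∣rs with euclidsLemma r s p-prime p∣rs
    ... | inj₁ p∣r = p∤r p∣r
    ... | inj₂ p∣s = p∤s p∣s

  vp≡0 : ∀ {m} → 0 < m → ¬ p ∣ m → vp p m ≡ 0
  vp≡0 {m} 0<m p∤m = vp-unique 0<m (m , sym (*-identityˡ m) , p∤m)

  vp-p* : ∀ {m} → 0 < m → vp p (p * m) ≡ suc (vp p m)
  vp-p* {m} 0<m =
    vp-unique {p * m} {suc (vp p m)} (*-mono-≤ {1} {p} (s≤s z≤n) 0<m)
              (isValuation-p* {m} {vp p m} (vp-isValuation 0<m))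

  vp-^ : ∀ n → vp p (p ^ n) ≡ n
  vp-^ n = vp-unique (m^n>0 p n) (1 , sym (*-identityʳ (p ^ n)) , p∤1)
    where
    p∤1 : ¬ p ∣ 1
    p∤1 p∣1 = 1+n≢0 (cong pred (∣1⇒≡1 p∣1))

module Expansion (q : ℕ) (p-prime : Prime (suc (suc q))) where

  open Valuation q

  vpFact : ℕ → ℕ
  vpFact n = vp p (n !)

  vpFact-suc : ∀ n → vpFact (suc n) ≡ vp p (suc n) + vpFact n
  vpFact-suc n = vp-* p-prime (s≤s z≤n) (1≤n! n)

  vpFact-mono : ∀ {m n} → m ≤ n → vpFact m ≤ vpFact n
  vpFact-mono {n = zero}  z≤n = ≤-refl
  vpFact-mono {m} {suc n} m≤1+n with m≤n⇒m<n∨m≡n m≤1+n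
  ... | inj₂ refl  = ≤-refl
  ... | inj₁ m<1+n = ≤-trans (vpFact-mono (≤-pred m<1+n))
                             (subst (vpFact n ≤_) (sym (vpFact-suc n)) (m≤n+m _ _))

  vpFact-block : ∀ m r → r < p → vpFact (m * p + r) ≡ vpFact (m * p)
  vpFact-block m zero    _       = cong vpFact (+-identityʳ (m * p))
  vpFact-block m (suc r) 1+r<p = begin
    vpFact (m * p + suc r)                         ≡⟨ cong vpFact (+-suc (m * p) r) ⟩
    vpFact (suc (m * p + r))                       ≡⟨ vpFact-suc (m * p + r) ⟩
    vp p (suc (m * p + r)) + vpFact (m * p + r)    ≡⟨ cong₂ _+_ (vp≡0 (s≤s z≤n) p∤)
                                                              (vpFact-block m r (<⇒≤ 1+r<p)) ⟩
    vpFact (m * p)                                 ∎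
    where
    open ≡-Reasoning
    p∤ : ¬ p ∣ suc (m * p + r)
    p∤ p∣ = <⇒≱ 1+r<p (∣⇒≤ (∣m+n∣m⇒∣n p∣m*p+1+r (n∣m*n m)))
      where p∣m*p+1+r = subst (p ∣_) (sym (+-suc (m * p) r)) p∣

  -- the digits 1 of the sum sit exactly at the positions pos m
  pos : ℕ → ℕ
  pos m = suc (vpFact (m * p))

  pos-suc : ∀ m → pos (suc m) ≡ pos m + suc (vp p (suc m))
  pos-suc m = cong suc (begin
    vpFact (suc m * p)                                   ≡⟨ cong vpFact 1+m*p≡ ⟩
    vpFact (suc (m * p + suc q))                         ≡⟨ vpFact-suc (m * p + suc q) ⟩
    vp p (suc (m * p + suc q)) + vpFact (m * p + suc q)  ≡⟨ cong₂ _+_ vp-last (vpFact-block m (suc q) ≤-refl) ⟩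
    suc (vp p (suc m)) + vpFact (m * p)                  ≡⟨ +-comm (suc (vp p (suc m))) _ ⟩
    vpFact (m * p) + suc (vp p (suc m))                  ∎)
    where
    open ≡-Reasoning
    1+m*p≡ : suc m * p ≡ suc (m * p + suc q)
    1+m*p≡ = cong suc (+-comm (suc q) (m * p))
    vp-last : vp p (suc (m * p + suc q)) ≡ suc (vp p (suc m))
    vp-last = trans (cong (vp p) (trans (sym 1+m*p≡) (*-comm (suc m) p))) (vp-p* (s≤s z≤n))

  pos-< : ∀ m → pos m < pos (suc m)
  pos-< m = subst (pos m <_) (sym (pos-suc m)) (m<m+n (pos m) (s≤s z≤n))

  pos-mono : ∀ {m n} → m ≤ n → pos m ≤ pos n
  pos-mono m≤n = s≤s (vpFact-mono (*-monoˡ-≤ p m≤n))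

  n<pos : ∀ n → n < pos n
  n<pos zero    = s≤s z≤n
  n<pos (suc n) = ≤-trans (s≤s (n<pos n)) (pos-< n)

  pos≤vpFact : ∀ {m n} → suc m * p ≤ n → pos m ≤ vpFact n
  pos≤vpFact {m} 1+m*p≤n = ≤-trans (≤-pred (pos-< m)) (vpFact-mono 1+m*p≤n)

  S : ℕ → ℕ
  S = partialSum p

  partialSum-block : ∀ m r → r ≤ p → S (m * p + r) ≡ S (m * p) + r * p ^ vpFact (m * p)
  partialSum-block m zero    _      = trans (cong S (+-identityʳ (m * p))) (sym (+-identityʳ _))
  partialSum-block m (suc r) 1+r≤p = begin
    S (m * p + suc r)                       ≡⟨ cong S (+-suc (m * p) r) ⟩
    S (m * p + r) + p ^ vpFact (m * p + r)  ≡⟨ cong₂ _+_ (partialSum-block m r (<⇒≤ 1+r≤p))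
                                                      (cong (p ^_) (vpFact-block m r 1+r≤p)) ⟩
    S (m * p) + r * x + x                   ≡⟨ solve 3 (λ a r x → a :+ r :* x :+ x := a :+ (x :+ r :* x))
                                                       refl (S (m * p)) r x ⟩
    S (m * p) + suc r * x                   ∎
    where
    open ≡-Reasoning
    x = p ^ vpFact (m * p)

  partialSum-step : ∀ m → S (suc m * p) ≡ S (m * p) + p ^ pos m
  partialSum-step m = trans (cong S (+-comm p (m * p))) (partialSum-block m p ≤-refl)

  -- searching m ≤ k suffices, as m < pos m
  digit : ℕ → ℕ
  digit k = imageIndicator pos (suc k) k

  digit<p : ∀ k → digit k < p
  digit<p k = s≤s (≤-trans (imageIndicator-≤1 pos (suc k) k) (s≤s z≤n))

  digit-pos : ∀ m → digit (pos m) ≡ 1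
  digit-pos m = imageIndicator-hit pos (m≤n⇒m≤1+n (n<pos m))

  digit-gap : ∀ J {k} → (∀ j → j < J → pos j < k) → k < pos J → digit k ≡ 0
  digit-gap J {k} below k<pos = imageIndicator-miss pos (suc k) k∉pos
    where
    k∉pos : ∀ m → pos m ≢ k
    k∉pos m pos≡k with m <? J
    ... | yes m<J = <⇒≢ (below m m<J) pos≡k
    ... | no  m≮J = <⇒≢ (<-≤-trans k<pos (pos-mono (≮⇒≥ m≮J))) (sym pos≡k)

  D : ℕ → ℕ
  D = digitSum digit p

  -- J counts the digits 1 below position k.
  digitSum≡partialSum : ∀ k → Σ ℕ λ J →
    D k ≡ S (J * p) × (∀ j → j < J → pos j < k) × k ≤ pos J
  digitSum≡partialSum zero = 0 , refl , (λ _ ()) , z≤n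
  digitSum≡partialSum (suc k) with digitSum≡partialSum k
  ... | J , Dk≡ , below , k≤pos with pos J ≟ k
  ...   | yes refl = suc J , D≡ , below′ , pos-< J
    where
    D≡ : D (suc k) ≡ S (suc J * p)
    D≡ = begin
      D k + digit (pos J) * p ^ pos J    ≡⟨ cong₂ (λ x d → x + d * p ^ pos J) Dk≡ (digit-pos J) ⟩
      S (J * p) + 1 * p ^ pos J          ≡⟨ cong (S (J * p) +_) (*-identityˡ _) ⟩
      S (J * p) + p ^ pos J              ≡⟨ sym (partialSum-step J) ⟩
      S (suc J * p)                      ∎
      where open ≡-Reasoning
    below′ : ∀ j → j < suc J → pos j < suc (pos J)
    below′ j j<1+J = s≤s (pos-mono (≤-pred j<1+J))
  ...   | no pos≢k = J , D≡ , (λ j j<J → m≤n⇒m≤1+n (below j j<J)) , k<pos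
    where
    k<pos : k < pos J
    k<pos = ≤∧≢⇒< k≤pos (pos≢k ∘ sym)
    D≡ : D (suc k) ≡ S (J * p)
    D≡ = begin
      D k + digit k * p ^ k    ≡⟨ cong (λ d → D k + d * p ^ k) (digit-gap J below k<pos) ⟩
      D k + 0                  ≡⟨ +-identityʳ _ ⟩
      D k                      ≡⟨ Dk≡ ⟩
      S (J * p)                ∎
      where open ≡-Reasoning

  digit-converges : SeriesConvergesTo p digit
  digit-converges k with digitSum≡partialSum k
  ... | J , Dk≡ , _ , k≤pos = suc J * p , λ N N₀≤N →
    congrMod-trans (sumBelow-congrMod _ (suc J * p) p^k∣term N N₀≤N) head
    where
    p^k∣term : ∀ n → suc J * p ≤ n → p ^ k ∣ p ^ vpFact n
    p^k∣term n N₀≤n = m^n∣m^o p (≤-trans k≤pos (pos≤vpFact {J} N₀≤n))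
    head : CongrMod (p ^ k) (S (suc J * p)) (D k)
    head rewrite partialSum-step J | Dk≡ = congrMod-+ʳ (S (J * p)) (m^n∣m^o p k≤pos)

  n<p^n : ∀ n → n < p ^ n
  n<p^n zero    = s≤s z≤n
  n<p^n (suc n) = ≤-<-trans (n<p^n n) (subst (p ^ n <_) (*-comm (p ^ n) p) p^n<p^n*p)
    where
    instance _ = m^n≢0 p n
    p^n<p^n*p : p ^ n < p ^ n * p
    p^n<p^n*p = m<m*n (p ^ n) p (s≤s (s≤s z≤n))

  digit-zeroRun : ∀ L → ZeroRun digit L
  digit-zeroRun L = pos m , L≤pos , digit-pos m , zeros
    where
    instance _ = m^n≢0 p L
    m = pred (p ^ L)
    1+m≡p^L : suc m ≡ p ^ L
    1+m≡p^L = suc-pred (p ^ L)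
    L≤pos : L ≤ pos m
    L≤pos = <⇒≤ (≤-trans (n<p^n L) (subst (_≤ pos m) 1+m≡p^L (n<pos m)))
    zeros : ∀ i → 0 < i → i ≤ L → digit (pos m + i) ≡ 0
    zeros i 0<i i≤L = digit-gap (suc m) below before-next
      where
      below : ∀ j → j < suc m → pos j < pos m + i
      below j j<1+m = ≤-<-trans (pos-mono (≤-pred j<1+m)) (m<m+n (pos m) 0<i)
      i≤vp : i ≤ vp p (suc m)
      i≤vp = subst (i ≤_) (sym (trans (cong (vp p) 1+m≡p^L) (vp-^ L))) i≤L
      before-next : pos m + i < pos (suc m)
      before-next = subst (pos m + i <_) (sym (pos-suc m)) (+-monoʳ-< (pos m) (s≤s i≤vp))

theorem3 : (p : ℕ) → Prime p →
    Σ (ℕ → ℕ) λ a → (∀ i → a i < p) × SeriesConvergesTo p a × ¬ EventuallyPeriodic a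
theorem3 (suc (suc q)) p-prime =
  digit , digit<p , digit-converges , unboundedZeroRuns⇒¬EventuallyPeriodic digit digit-zeroRun
  where open Expansion q p-prime
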